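{- Let $n$ be a positive multiple of $3$ and $k$ an integer with $n/3<k<n/2$; put $v:=n/3$ and $m:=n-2k-1$, and write $S:=S_m(v)$, $T:=T_m(v)$, $U:=U_m(v)$. Then the number of edges of the digraph $D_0(v,m)$ is exactly \[ E(k,n):=2m^2\binom{S}{3}+\binom{m}{2}\binom{S}{2}+2mT\binom{S}{2}+\binom{T}{2}S+(U+1)\bigl(m(S-1)+T\bigr). \]
   Context: For positive integers $v,m$, $D_0(v,m)$ is the digraph on vertices $1,\dots,v$ defined recursively by: $[1]^-=0$; for each $i\ge1$, $[i]^+=\min\{[i]^-+m,\;v-i\}$; and for $1\le i<j\le v$, $i\to j$ is an edge iff $i+1\le j\le i+[i]^+$ (where $[i]^+,[i]^-$ are outdegree and indegree). For positive integers $j,i$, $S_j(i)$ is the unique nonnegative integer with $\binom{S_j(i)}{2}<\frac{i}{j}\le\binom{S_j(i)+1}{2}$, and $T_j(i),U_j(i)$ are the unique integers with $0\le T_j(i)\le j-1$, $0\le U_j(i)\le S_j(i)-1$ and $i=1+j\binom{S_j(i)}{2}+S_j(i)T_j(i)+U_j(i)$. -}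

module Defs where

open import Data.Nat using (ℕ; zero; suc; _+_; _*_; _∸_; _⊓_; _≤_; _<_; _≤ᵇ_)
open import Data.Nat.Combinatorics using (_C_)
open import Data.Bool using (Bool; true; false; if_then_else_; _∧_)
open import Data.List using (List; []; _∷_; _++_; length; lookup)
open import Data.Fin using (Fin)
open import Data.Product using (_×_)
open import Relation.Binary.PropositionalEquality using (_≡_)

⟦_⟧ : Bool → ℕ
⟦ true ⟧ = 1
⟦ false ⟧ = 0

countFrom : ℕ → ℕ → (ℕ → Bool) → ℕ
countFrom lo zero p = 0
countFrom lo (suc len) p = ⟦ p lo ⟧ + countFrom (suc lo) len p

-- i-th element of a list (1-indexed); 0 if out of range
at : List ℕ → ℕ → ℕ
at [] _ = 0
at (x ∷ xs) zero = 0
at (x ∷ xs) (suc zero) = x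
at (x ∷ xs) (suc (suc i)) = at xs (suc i)

-- outDegs v m t = [ [1]^+ , ..., [t]^+ ] for the digraph D_0(v,m), computed by
-- the recursion of the paper: [i]^- is the number of i' < i with an edge i' -> i,
-- i.e. with i'+1 ≤ i ≤ i' + [i']^+ ; and [i]^+ = min([i]^- + m, v - i).
outDegs : ℕ → ℕ → ℕ → List ℕ
outDegs v m zero = []
outDegs v m (suc t) =
  let ds = outDegs v m t
      i = suc t
      indeg = countFrom 1 t (λ i' → i ≤ᵇ i' + at ds i')
  in ds ++ ((indeg + m) ⊓ (v ∸ i) ∷ [])

outDeg : ℕ → ℕ → ℕ → ℕ
outDeg v m i = at (outDegs v m i) i

edge? : ℕ → ℕ → ℕ → ℕ → Bool
edge? v m i j = (suc i ≤ᵇ j) ∧ (j ≤ᵇ v) ∧ (1 ≤ᵇ i) ∧ (j ≤ᵇ i + outDeg v m i)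

sumFrom : ℕ → ℕ → (ℕ → ℕ) → ℕ
sumFrom lo zero f = 0
sumFrom lo (suc len) f = f lo + sumFrom (suc lo) len f

numEdges : ℕ → ℕ → ℕ
numEdges v m = sumFrom 1 v (λ i → countFrom 1 v (λ j → edge? v m i j))

-- The characterising conditions of S = S_j(i), T = T_j(i), U = U_j(i) (j, i positive):
-- C(S,2) < i/j ≤ C(S+1,2)  (cleared of the denominator j > 0),
-- 0 ≤ T ≤ j-1, 0 ≤ U ≤ S-1, and i = 1 + j C(S,2) + S T + U.
IsS : ℕ → ℕ → ℕ → Set
IsS j i S = (j * (S C 2) < i) × (i ≤ j * (suc S C 2))

IsTU : ℕ → ℕ → ℕ → ℕ → ℕ → Set
IsTU j i S T U = (T < j) × (U < S) × (i ≡ 1 + j * (S C 2) + S * T + U)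

E : ℕ → ℕ → ℕ → ℕ → ℕ
E m S T U = 2 * (m * m) * (S C 3) + (m C 2) * (S C 2) + 2 * m * T * (S C 2)
          + (T C 2) * S + (U + 1) * (m * (S ∸ 1) + T)

module Submission where

open import Data.Bool using (Bool; true; false)
open import Data.Bool.Properties using (T-≡; ¬-not)
open import Data.List using (List; []; _∷_; _++_; length)
open import Data.List.Properties using (length-++)
open import Data.Nat using (ℕ; zero; suc; _+_; _*_; _∸_; _⊓_; _≤_; _<_; _≤ᵇ_; z≤n; s≤s; z<s; _<?_)
open import Data.Nat.Combinatorics using (_C_; nCk+nC[k+1]≡[n+1]C[k+1]; nC1≡n)
open import Data.Nat.Divisibility using (divides-refl)
open import Data.Nat.DivMod using (_%_; _/_; [m+kn]%n≡m%n; m<n⇒m%n≡m; +-distrib-/-∣ʳ; m<n⇒m/n≡0; m*n/n≡m)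
open import Data.Nat.Properties
open import Data.Nat.Tactic.RingSolver using (solve-∀)
open import Data.Product using (_×_; _,_; proj₁; proj₂; ∃)
open import Data.Sum using (inj₁; inj₂)
open import Function.Bundles using (Equivalence)
open import Relation.Binary.PropositionalEquality
open import Relation.Nullary using (yes; no; ¬_)

open import Defs

-- Write vertex i as i = 1 + m C(S,2) + S T + U with T < m, U < S: block S, row T, column U.
-- The closed form m (S - 1) + T for [i]^- is nondecreasing in i, so the i' < j with
-- j ≤ i' + [i']^- + m form a final segment of [1, j); its left end is the vertex with the
-- same row and column one block back, which leaves exactly m (S - 1) + T of them. The cap
-- v - i on [i]^+ never matters for targets j ≤ v. Summing the in-degrees row by row, a full
-- row T of block S contributes S (m (S - 1) + T), and these contributions add up to E.

[1+n]C2≡n+nC2 : ∀ n → suc n C 2 ≡ n + n C 2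
[1+n]C2≡n+nC2 n = trans (sym (nCk+nC[k+1]≡[n+1]C[k+1] n 1)) (cong (_+ n C 2) (nC1≡n n))

[1+n]C3≡nC2+nC3 : ∀ n → suc n C 3 ≡ n C 2 + n C 3
[1+n]C3≡nC2+nC3 n = sym (nCk+nC[k+1]≡[n+1]C[k+1] n 2)

2*nC2≡n*[n∸1] : ∀ n → 2 * (n C 2) ≡ n * (n ∸ 1)
2*nC2≡n*[n∸1] zero = refl
2*nC2≡n*[n∸1] (suc zero) = refl
2*nC2≡n*[n∸1] (suc (suc n)) = begin
  2 * (suc (suc n) C 2)          ≡⟨ cong (2 *_) ([1+n]C2≡n+nC2 (suc n)) ⟩
  2 * (suc n + suc n C 2)        ≡⟨ *-distribˡ-+ 2 (suc n) (suc n C 2) ⟩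
  2 * suc n + 2 * (suc n C 2)    ≡⟨ cong (2 * suc n +_) (2*nC2≡n*[n∸1] (suc n)) ⟩
  2 * suc n + suc n * n          ≡⟨ collect n ⟩
  suc (suc n) * suc n            ∎
  where
  open ≡-Reasoning
  collect : ∀ n → 2 * suc n + suc n * n ≡ suc (suc n) * suc n
  collect = solve-∀

C2-mono-≤ : ∀ {a b} → a ≤ b → a C 2 ≤ b C 2
C2-mono-≤ {b = zero} z≤n = ≤-refl
C2-mono-≤ {a} {suc b} a≤1+b with m≤n⇒m<n∨m≡n a≤1+b
... | inj₁ (s≤s a≤b) = ≤-trans (C2-mono-≤ a≤b) (≤-trans (m≤n+m (b C 2) b) (≤-reflexive (sym ([1+n]C2≡n+nC2 b))))
... | inj₂ refl = ≤-refl

≤⇒≤ᵇ≡true : ∀ {m n} → m ≤ n → (m ≤ᵇ n) ≡ true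
≤⇒≤ᵇ≡true m≤n = Equivalence.to T-≡ (≤⇒≤ᵇ m≤n)

>⇒≤ᵇ≡false : ∀ {m n} → n < m → (m ≤ᵇ n) ≡ false
>⇒≤ᵇ≡false {m} {n} n<m = ¬-not λ m≤ᵇn → <⇒≱ n<m (≤ᵇ⇒≤ m n (Equivalence.from T-≡ m≤ᵇn))

sumFrom-cong : ∀ lo n {f g : ℕ → ℕ} → (∀ x → lo ≤ x → x < lo + n → f x ≡ g x) →
               sumFrom lo n f ≡ sumFrom lo n g
sumFrom-cong lo zero f≗g = refl
sumFrom-cong lo (suc n) f≗g = cong₂ _+_ (f≗g lo ≤-refl (m<m+n lo z<s))
  (sumFrom-cong (suc lo) n λ x lo<x x< → f≗g x (<⇒≤ lo<x) (subst (x <_) (sym (+-suc lo n)) x<))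

sumFrom-zero : ∀ lo n → sumFrom lo n (λ _ → 0) ≡ 0
sumFrom-zero lo zero = refl
sumFrom-zero lo (suc n) = sumFrom-zero (suc lo) n

sumFrom-distrib-+ : ∀ lo n (f g : ℕ → ℕ) →
                    sumFrom lo n (λ x → f x + g x) ≡ sumFrom lo n f + sumFrom lo n g
sumFrom-distrib-+ lo zero f g = refl
sumFrom-distrib-+ lo (suc n) f g rewrite sumFrom-distrib-+ (suc lo) n f g =
  +-+-comm (f lo) (g lo) (sumFrom (suc lo) n f) (sumFrom (suc lo) n g)
  where
  +-+-comm : ∀ a b c d → a + b + (c + d) ≡ a + c + (b + d)
  +-+-comm = solve-∀

sumFrom-swap : ∀ a n b l (f : ℕ → ℕ → ℕ) →
               sumFrom a n (λ i → sumFrom b l (f i)) ≡ sumFrom b l (λ j → sumFrom a n (λ i → f i j))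
sumFrom-swap a zero b l f = sym (sumFrom-zero b l)
sumFrom-swap a (suc n) b l f rewrite sumFrom-swap (suc a) n b l f =
  sym (sumFrom-distrib-+ b l (f a) (λ j → sumFrom (suc a) n (λ i → f i j)))

sumFrom-snoc : ∀ lo n (f : ℕ → ℕ) → sumFrom lo (suc n) f ≡ sumFrom lo n f + f (lo + n)
sumFrom-snoc lo zero f = trans (+-identityʳ _) (cong f (sym (+-identityʳ lo)))
sumFrom-snoc lo (suc n) f rewrite sumFrom-snoc (suc lo) n f | +-suc lo n = sym (+-assoc (f lo) _ _)

countFrom≡sumFrom : ∀ lo n (p : ℕ → Bool) → countFrom lo n p ≡ sumFrom lo n (λ x → ⟦ p x ⟧)
countFrom≡sumFrom lo zero p = refl
countFrom≡sumFrom lo (suc n) p = cong (⟦ p lo ⟧ +_) (countFrom≡sumFrom (suc lo) n p)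

countFrom-cong : ∀ lo n {p q : ℕ → Bool} → (∀ x → lo ≤ x → x < lo + n → p x ≡ q x) →
                 countFrom lo n p ≡ countFrom lo n q
countFrom-cong lo n {p} {q} p≗q = begin
  countFrom lo n p                  ≡⟨ countFrom≡sumFrom lo n p ⟩
  sumFrom lo n (λ x → ⟦ p x ⟧)      ≡⟨ sumFrom-cong lo n (λ x lo≤x x< → cong ⟦_⟧ (p≗q x lo≤x x<)) ⟩
  sumFrom lo n (λ x → ⟦ q x ⟧)      ≡⟨ countFrom≡sumFrom lo n q ⟨
  countFrom lo n q                  ∎
  where open ≡-Reasoning

countFrom-all : ∀ lo n {p : ℕ → Bool} → (∀ x → lo ≤ x → p x ≡ true) → countFrom lo n p ≡ n
countFrom-all lo zero all = refl
countFrom-all lo (suc n) all rewrite all lo ≤-refl =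
  cong suc (countFrom-all (suc lo) n λ x lo<x → all x (<⇒≤ lo<x))

countFrom-none : ∀ lo n {p : ℕ → Bool} → (∀ x → lo ≤ x → p x ≡ false) → countFrom lo n p ≡ 0
countFrom-none lo zero none = refl
countFrom-none lo (suc n) none rewrite none lo ≤-refl =
  countFrom-none (suc lo) n λ x lo<x → none x (<⇒≤ lo<x)

countFrom-threshold : ∀ lo k c {p : ℕ → Bool} → (∀ x → x < lo + k → p x ≡ false) →
                      (∀ x → lo + k ≤ x → p x ≡ true) → countFrom lo (k + c) p ≡ c
countFrom-threshold lo zero c below above =
  countFrom-all lo c λ x lo≤x → above x (subst (_≤ x) (sym (+-identityʳ lo)) lo≤x)
countFrom-threshold lo (suc k) c below above rewrite below lo (m<m+n lo z<s) =
  countFrom-threshold (suc lo) k c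
    (λ x x< → below x (subst (x <_) (sym (+-suc lo k)) x<))
    (λ x ≤x → above x (subst (_≤ x) (sym (+-suc lo k)) ≤x))

countFrom-truncate : ∀ lo a n {p q : ℕ → Bool} → a ≤ n → (∀ x → lo ≤ x → x < lo + a → p x ≡ q x) →
                     (∀ x → lo + a ≤ x → p x ≡ false) → countFrom lo n p ≡ countFrom lo a q
countFrom-truncate lo zero n _ _ none =
  countFrom-none lo n λ x lo≤x → none x (subst (_≤ x) (sym (+-identityʳ lo)) lo≤x)
countFrom-truncate lo (suc a) (suc n) (s≤s a≤n) p≗q none =
  cong₂ _+_ (cong ⟦_⟧ (p≗q lo ≤-refl (m<m+n lo z<s)))
    (countFrom-truncate (suc lo) a n a≤n
      (λ x lo<x x< → p≗q x (<⇒≤ lo<x) (subst (x <_) (sym (+-suc lo a)) x<))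
      (λ x ≤x → none x (subst (_≤ x) (sym (+-suc lo a)) ≤x)))

Coords : Set
Coords = ℕ × ℕ × ℕ

IsCoords : ℕ → ℕ → Coords → Set
IsCoords m i (S , T , U) = IsTU m i S T U

next : ℕ → Coords → Coords
next m (S , T , U) with suc U <? S
... | yes _ = S , T , suc U
... | no _ with suc T <? m
...   | yes _ = S , suc T , 0
...   | no _ = suc S , 0 , 0

-- coords m i are the coordinates of vertex suc i.
coords : ℕ → ℕ → Coords
coords m zero = 1 , 0 , 0
coords m (suc i) = next m (coords m i)

next-correct : ∀ {m i} t → IsCoords m i t → IsCoords m (suc i) (next m t)
next-correct {m} (S , T , U) (T<m , U<S , i≡) with suc U <? S
... | yes 1+U<S = T<m , 1+U<S , trans (cong suc i≡) (sym (+-suc _ U))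
... | no 1+U≮S with refl ← ≤∧≮⇒≡ U<S 1+U≮S with suc T <? m
...   | yes 1+T<m = 1+T<m , z<s , trans (cong suc i≡) (next-row _ T U)
  where
  next-row : ∀ c T U → suc (1 + c + suc U * T + U) ≡ 1 + c + suc U * suc T + 0
  next-row = solve-∀
...   | no 1+T≮m with refl ← ≤∧≮⇒≡ T<m 1+T≮m =
  z<s , z<s , trans (cong suc i≡) (trans (next-block _ T U)
    (cong (λ c → 1 + suc T * c + suc (suc U) * 0 + 0) (sym ([1+n]C2≡n+nC2 (suc U)))))
  where
  next-block : ∀ c T U → suc (1 + suc T * c + suc U * T + U) ≡ 1 + suc T * (suc U + c) + suc (suc U) * 0 + 0
  next-block = solve-∀

coords-correct : ∀ {m} → 0 < m → ∀ i → IsCoords m (suc i) (coords m i)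
coords-correct {m} 0<m zero = 0<m , z<s , cong (λ x → 1 + x + 0 + 0) (sym (*-zeroʳ m))
coords-correct 0<m (suc i) = next-correct _ (coords-correct 0<m i)

IsTU⇒IsS : ∀ {m i S T U} → IsTU m i S T U → IsS m i S
IsTU⇒IsS {m} {i} {S} {T} {U} (T<m , U<S , i≡) = lower , upper
  where
  lower : m * (S C 2) < i
  lower = subst (m * (S C 2) <_) (sym i≡) (s≤s (≤-trans (m≤m+n _ (S * T)) (m≤m+n _ U)))
  upper : i ≤ m * (suc S C 2)
  upper = begin
    i                                   ≡⟨ i≡ ⟩
    1 + m * (S C 2) + S * T + U         ≡⟨ regroup (m * (S C 2)) (S * T) U ⟩
    m * (S C 2) + (suc U + S * T)       ≤⟨ +-monoʳ-≤ (m * (S C 2)) (+-monoˡ-≤ (S * T) U<S) ⟩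
    m * (S C 2) + (S + S * T)           ≡⟨ cong (m * (S C 2) +_) (*-suc S T) ⟨
    m * (S C 2) + S * suc T             ≤⟨ +-monoʳ-≤ (m * (S C 2)) (*-monoʳ-≤ S T<m) ⟩
    m * (S C 2) + S * m                 ≡⟨ factor m S (S C 2) ⟩
    m * (S + S C 2)                     ≡⟨ cong (m *_) ([1+n]C2≡n+nC2 S) ⟨
    m * (suc S C 2)                     ∎
    where
    open ≤-Reasoning
    regroup : ∀ x y u → 1 + x + y + u ≡ x + (suc u + y)
    regroup = solve-∀
    factor : ∀ m S c → m * c + S * m ≡ m * (S + c)
    factor = solve-∀

IsS-≮ : ∀ {m i S S'} → IsS m i S → IsS m i S' → ¬ S < S'
IsS-≮ {m} (_ , i≤) (<i , _) S<S' = <⇒≱ <i (≤-trans i≤ (*-monoʳ-≤ m (C2-mono-≤ S<S')))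

IsS-unique : ∀ {m i S S'} → IsS m i S → IsS m i S' → S ≡ S'
IsS-unique {m} {i} {S} {S'} s s' =
  ≤-antisym (≮⇒≥ (IsS-≮ {m} {i} {S'} s' s)) (≮⇒≥ (IsS-≮ {m} {i} {S} s s'))

divMod-unique : ∀ {S T T' U U'} → U < S → U' < S → S * T + U ≡ S * T' + U' → T ≡ T' × U ≡ U'
divMod-unique {S@(suc _)} {T} {T'} U<S U'<S eq =
  trans (sym (quotient T U<S)) (trans (cong (_/ S) eq) (quotient T' U'<S)) ,
  trans (sym (remainder T U<S)) (trans (cong (_% S) eq) (remainder T' U'<S))
  where
  swap : ∀ T U → S * T + U ≡ U + T * S
  swap T U = trans (+-comm (S * T) U) (cong (U +_) (*-comm S T))
  quotient : ∀ T {U} → U < S → (S * T + U) / S ≡ T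
  quotient T {U} U<S = begin
    (S * T + U) / S     ≡⟨ cong (_/ S) (swap T U) ⟩
    (U + T * S) / S     ≡⟨ +-distrib-/-∣ʳ U (divides-refl T) ⟩
    U / S + T * S / S   ≡⟨ cong₂ _+_ (m<n⇒m/n≡0 U<S) (m*n/n≡m T S) ⟩
    T                   ∎
    where open ≡-Reasoning
  remainder : ∀ T {U} → U < S → (S * T + U) % S ≡ U
  remainder T {U} U<S = begin
    (S * T + U) % S     ≡⟨ cong (_% S) (swap T U) ⟩
    (U + T * S) % S     ≡⟨ [m+kn]%n≡m%n U T S ⟩
    U % S               ≡⟨ m<n⇒m%n≡m U<S ⟩
    U                   ∎
    where open ≡-Reasoning

IsTU-same-block : ∀ {m i S T T' U U'} → IsTU m i S T U → IsTU m i S T' U' → S * T + U ≡ S * T' + U'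
IsTU-same-block {m} {i} {S} {T} {T'} {U} {U'} (_ , _ , i≡) (_ , _ , i≡') =
  +-cancelˡ-≡ (1 + m * (S C 2)) _ _ (begin
    1 + m * (S C 2) + (S * T + U)    ≡⟨ +-assoc _ (S * T) U ⟨
    1 + m * (S C 2) + S * T + U      ≡⟨ trans (sym i≡) i≡' ⟩
    1 + m * (S C 2) + S * T' + U'    ≡⟨ +-assoc _ (S * T') U' ⟩
    1 + m * (S C 2) + (S * T' + U')  ∎)
  where open ≡-Reasoning

coords-unique : ∀ {m i} t t' → IsCoords m i t → IsCoords m i t' → t ≡ t'
coords-unique {m} {i} (S , T , U) (S' , T' , U') tu tu'
  with refl ← IsS-unique {m} {i} {S} {S'} (IsTU⇒IsS tu) (IsTU⇒IsS tu')
  with refl , refl ← divMod-unique (proj₁ (proj₂ tu)) (proj₁ (proj₂ tu')) (IsTU-same-block tu tu')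
  = refl

weight : ℕ → Coords → ℕ
weight m (S , T , U) = m * (S ∸ 1) + T

-- The closed form of [i]^-; the value at the non-vertex 0 is junk.
indegree : ℕ → ℕ → ℕ
indegree m zero = 0
indegree m (suc i) = weight m (coords m i)

indegree-of : ∀ {m i S T U} → 0 < m → IsTU m i S T U → indegree m i ≡ m * (S ∸ 1) + T
indegree-of {m} {suc i} 0<m tu = cong (weight m) (coords-unique _ _ (coords-correct 0<m i) tu)

weight-next-mono : ∀ {m i} t → IsCoords m i t → weight m t ≤ weight m (next m t)
weight-next-mono {m} (S , T , U) (T<m , U<S , _) with suc U <? S
... | yes _ = ≤-refl
... | no 1+U≮S with refl ← ≤∧≮⇒≡ U<S 1+U≮S with suc T <? m
...   | yes _ = +-monoʳ-≤ (m * U) (n≤1+n T)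
...   | no 1+T≮m with refl ← ≤∧≮⇒≡ T<m 1+T≮m =
  ≤-trans (+-monoʳ-≤ (suc T * U) (n≤1+n T)) (≤-reflexive (full-row T U))
  where
  full-row : ∀ T U → suc T * U + suc T ≡ suc T * suc U + 0
  full-row = solve-∀

indegree-mono-≤ : ∀ {m} → 0 < m → ∀ {a b} → a ≤ b → indegree m a ≤ indegree m b
indegree-mono-≤ 0<m {b = zero} z≤n = ≤-refl
indegree-mono-≤ {m} 0<m {a} {suc b} a≤1+b with m≤n⇒m<n∨m≡n a≤1+b
... | inj₂ refl = ≤-refl
... | inj₁ (s≤s a≤b) = ≤-trans (indegree-mono-≤ 0<m a≤b) (indegree-≤-suc b)
  where
  indegree-≤-suc : ∀ b → indegree m b ≤ indegree m (suc b)
  indegree-≤-suc zero = z≤n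
  indegree-≤-suc (suc b) = weight-next-mono _ (coords-correct 0<m b)

-- The last vertex an edge from i could reach if its out-degree were not capped by v - i.
reach : ℕ → ℕ → ℕ
reach m i = i + (indegree m i + m)

module _ {m : ℕ} (0<m : 0 < m) where

  reach-mono-≤ : ∀ {a b} → a ≤ b → reach m a ≤ reach m b
  reach-mono-≤ a≤b = +-mono-≤ a≤b (+-monoˡ-≤ m (indegree-mono-≤ 0<m a≤b))

  previous-block : ∀ {s T U} → T < m → U < suc (suc s) →
    ∃ λ i → m * (suc s C 2) + suc s * T + U ≤ i × i ≤ suc (m * (suc s C 2) + suc s * T + U)
          × indegree m i ≡ m * s + T
  previous-block {s} {T} {U} T<m U<2+s with m≤n⇒m<n∨m≡n (≤-pred U<2+s)
  ... | inj₁ U<1+s = _ , n≤1+n _ , ≤-refl , indegree-of 0<m (T<m , U<1+s , refl)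
  ... | inj₂ refl = _ , ≤-refl , n≤1+n _ ,
                    indegree-of 0<m (T<m , ≤-refl , +-suc (m * (suc s C 2) + suc s * T) s)

  count-reaching : ∀ {j S T U} → IsTU m (suc j) S T U →
                   countFrom 1 j (λ i → suc j ≤ᵇ reach m i) ≡ m * (S ∸ 1) + T
  count-reaching {S = zero} (_ , () , _)
  count-reaching {S = suc zero} {U = suc _} (_ , s≤s () , _)
  count-reaching {j} {suc zero} {T} {zero} (T<m , _ , 1+j≡) =
    trans (countFrom-all 1 j λ x _ → ≤⇒≤ᵇ≡true (≤-trans 1+j≤m (≤-trans (m≤n+m m _) (m≤n+m _ x))))
          (trans j≡T (cong (_+ T) (sym (*-zeroʳ m))))
    where
    first-block : ∀ m T → 1 + m * 0 + 1 * T + 0 ≡ suc T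
    first-block = solve-∀
    j≡T : j ≡ T
    j≡T = suc-injective (trans 1+j≡ (first-block m T))
    1+j≤m : suc j ≤ m
    1+j≤m = subst (_< m) (sym j≡T) T<m
  count-reaching {j} {suc (suc s)} {T} {U} (T<m , U<S , 1+j≡) =
    subst (λ n → countFrom 1 n (λ i → suc j ≤ᵇ reach m i) ≡ c) (sym j≡k+c) (countFrom-threshold 1 k c below above)
    where
    k = m * (suc s C 2) + suc s * T + U
    c = m * suc s + T
    j≡k+c : j ≡ k + c
    j≡k+c = trans (suc-injective 1+j≡)
      (trans (cong (λ x → m * x + suc (suc s) * T + U) ([1+n]C2≡n+nC2 (suc s))) (split m (suc s C 2) s T U))
      where
      split : ∀ m b s T U → m * (suc s + b) + suc (suc s) * T + U ≡ m * b + suc s * T + U + (m * suc s + T)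
      split = solve-∀
    witness = previous-block T<m U<S
    i = proj₁ witness
    k≤i = proj₁ (proj₂ witness)
    i≤1+k = proj₁ (proj₂ (proj₂ witness))
    indegree-i+m≡c : indegree m i + m ≡ c
    indegree-i+m≡c = trans (cong (_+ m) (proj₂ (proj₂ (proj₂ witness)))) (shift m s T)
      where
      shift : ∀ m s T → m * s + T + m ≡ m * suc s + T
      shift = solve-∀
    below : ∀ x → x < suc k → (suc j ≤ᵇ reach m x) ≡ false
    below x (s≤s x≤k) = >⇒≤ᵇ≡false (s≤s (begin
      reach m x                    ≤⟨ reach-mono-≤ x≤k ⟩
      k + (indegree m k + m)       ≤⟨ +-monoʳ-≤ k (+-monoˡ-≤ m (indegree-mono-≤ 0<m k≤i)) ⟩
      k + (indegree m i + m)       ≡⟨ cong (k +_) indegree-i+m≡c ⟩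
      k + c                        ≡⟨ j≡k+c ⟨
      j                            ∎))
      where open ≤-Reasoning
    above : ∀ x → suc k ≤ x → (suc j ≤ᵇ reach m x) ≡ true
    above x 1+k≤x = ≤⇒≤ᵇ≡true (begin
      suc j                            ≡⟨ cong suc j≡k+c ⟩
      suc k + c                        ≡⟨ cong (suc k +_) indegree-i+m≡c ⟨
      suc k + (indegree m i + m)       ≤⟨ +-monoʳ-≤ (suc k) (+-monoˡ-≤ m (indegree-mono-≤ 0<m i≤1+k)) ⟩
      reach m (suc k)                  ≤⟨ reach-mono-≤ 1+k≤x ⟩
      reach m x                        ∎)
      where open ≤-Reasoning

  indegree-recursion : ∀ j → countFrom 1 j (λ i → suc j ≤ᵇ reach m i) ≡ indegree m (suc j)
  indegree-recursion j = count-reaching′ (coords m j) (coords-correct 0<m j)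
    where
    count-reaching′ : ∀ t → IsCoords m (suc j) t → countFrom 1 j (λ i → suc j ≤ᵇ reach m i) ≡ weight m t
    count-reaching′ (S , T , U) = count-reaching

at-++-< : ∀ (xs : List ℕ) y i → i < length xs → at (xs ++ y ∷ []) (suc i) ≡ at xs (suc i)
at-++-< (x ∷ xs) y zero _ = refl
at-++-< (x ∷ xs) y (suc i) (s≤s i<n) = at-++-< xs y i i<n

at-++-length : ∀ (xs : List ℕ) y {n} → length xs ≡ n → at (xs ++ y ∷ []) (suc n) ≡ y
at-++-length [] y refl = refl
at-++-length (x ∷ xs) y refl = at-++-length xs y refl

length-outDegs : ∀ v m t → length (outDegs v m t) ≡ t
length-outDegs v m zero = refl
length-outDegs v m (suc t) =
  trans (length-++ (outDegs v m t)) (trans (cong (_+ 1) (length-outDegs v m t)) (+-comm t 1))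

≤ᵇ-+-capped : ∀ {j v} i a → j ≤ v → (j ≤ᵇ i + a ⊓ (v ∸ i)) ≡ (j ≤ᵇ i + a)
≤ᵇ-+-capped {j} {v} i a j≤v with ≤-total a (v ∸ i)
... | inj₁ a≤ rewrite m≤n⇒m⊓n≡m a≤ = refl
... | inj₂ ≤a rewrite m≥n⇒m⊓n≡n ≤a =
  trans (≤⇒≤ᵇ≡true j≤i+[v∸i]) (sym (≤⇒≤ᵇ≡true (≤-trans j≤i+[v∸i] (+-monoʳ-≤ i ≤a))))
  where
  j≤i+[v∸i] : j ≤ i + (v ∸ i)
  j≤i+[v∸i] = ≤-trans j≤v (m≤n+m∸n v i)

module _ {m v : ℕ} (0<m : 0 < m) where

  mutual
    at-outDegs : ∀ t → t ≤ v → ∀ i → 1 ≤ i → i ≤ t → at (outDegs v m t) i ≡ (indegree m i + m) ⊓ (v ∸ i)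
    at-outDegs (suc t) 1+t≤v (suc i) _ (s≤s i≤t) with m≤n⇒m<n∨m≡n i≤t
    ... | inj₁ i<t =
      trans (at-++-< (outDegs v m t) _ i (subst (i <_) (sym (length-outDegs v m t)) i<t))
            (at-outDegs t (<⇒≤ 1+t≤v) (suc i) z<s i<t)
    ... | inj₂ refl =
      trans (at-++-length (outDegs v m i) _ (length-outDegs v m i))
            (cong (λ d → (d + m) ⊓ (v ∸ suc i)) (indegree-outDegs i 1+t≤v))

    indegree-outDegs : ∀ t → suc t ≤ v →
                       countFrom 1 t (λ i → suc t ≤ᵇ i + at (outDegs v m t) i) ≡ indegree m (suc t)
    indegree-outDegs t 1+t≤v = trans (countFrom-cong 1 t capped) (indegree-recursion 0<m t)
      where
      capped : ∀ i → 1 ≤ i → i < 1 + t → (suc t ≤ᵇ i + at (outDegs v m t) i) ≡ (suc t ≤ᵇ reach m i)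
      capped i 1≤i (s≤s i≤t) =
        trans (cong (λ d → suc t ≤ᵇ i + d) (at-outDegs t (<⇒≤ 1+t≤v) i 1≤i i≤t)) (≤ᵇ-+-capped i _ 1+t≤v)

  outDeg≡ : ∀ i → 1 ≤ i → i ≤ v → outDeg v m i ≡ (indegree m i + m) ⊓ (v ∸ i)
  outDeg≡ i 1≤i i≤v = at-outDegs i i≤v i 1≤i ≤-refl

  column-count : ∀ j → suc j ≤ v → countFrom 1 v (λ i → edge? v m i (suc j)) ≡ indegree m (suc j)
  column-count j 1+j≤v =
    trans (countFrom-truncate 1 j v (<⇒≤ 1+j≤v) edge≡reaching no-edge) (indegree-recursion 0<m j)
    where
    edge≡reaching : ∀ i → 1 ≤ i → i < 1 + j → edge? v m i (suc j) ≡ (suc j ≤ᵇ reach m i)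
    edge≡reaching i 1≤i i<1+j@(s≤s i≤j)
      rewrite ≤⇒≤ᵇ≡true i<1+j | ≤⇒≤ᵇ≡true 1+j≤v | ≤⇒≤ᵇ≡true 1≤i
            | outDeg≡ i 1≤i (≤-trans i≤j (<⇒≤ 1+j≤v)) = ≤ᵇ-+-capped i _ 1+j≤v
    no-edge : ∀ i → 1 + j ≤ i → edge? v m i (suc j) ≡ false
    no-edge i 1+j≤i rewrite >⇒≤ᵇ≡false {suc i} {suc j} (s≤s 1+j≤i) = refl

  numEdges≡∑indegree : numEdges v m ≡ sumFrom 1 v (indegree m)
  numEdges≡∑indegree = begin
    sumFrom 1 v (λ i → countFrom 1 v (edge? v m i))
      ≡⟨ sumFrom-cong 1 v (λ i _ _ → countFrom≡sumFrom 1 v (edge? v m i)) ⟩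
    sumFrom 1 v (λ i → sumFrom 1 v (λ j → ⟦ edge? v m i j ⟧))
      ≡⟨ sumFrom-swap 1 v 1 v (λ i j → ⟦ edge? v m i j ⟧) ⟩
    sumFrom 1 v (λ j → sumFrom 1 v (λ i → ⟦ edge? v m i j ⟧))
      ≡⟨ sumFrom-cong 1 v (λ j _ _ → countFrom≡sumFrom 1 v (λ i → edge? v m i j)) ⟨
    sumFrom 1 v (λ j → countFrom 1 v (λ i → edge? v m i j))
      ≡⟨ sumFrom-cong 1 v (λ { (suc j) _ (s≤s j<v) → column-count j j<v }) ⟩
    sumFrom 1 v (indegree m)
      ∎
    where open ≡-Reasoning

-- The in-degree sum over the vertices before (S, T, 0); E m S T U unfolds to
-- edgesBefore m S T + (U + 1) (m (S - 1) + T).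
edgesBefore : ℕ → ℕ → ℕ → ℕ
edgesBefore m S T = 2 * (m * m) * (S C 3) + (m C 2) * (S C 2) + 2 * m * T * (S C 2) + (T C 2) * S

edgesBefore-sucʳ : ∀ m S T → edgesBefore m S (suc T) ≡ edgesBefore m S T + S * (m * (S ∸ 1) + T)
edgesBefore-sucʳ m S T rewrite [1+n]C2≡n+nC2 T = begin
  a + 2 * m * suc T * c + (T + T C 2) * S               ≡⟨ expand a m T c (T C 2) S ⟩
  a + 2 * m * T * c + (T C 2) * S + (m * (2 * c) + T * S) ≡⟨ cong (λ y → edgesBefore m S T + (m * y + T * S)) (2*nC2≡n*[n∸1] S) ⟩
  edgesBefore m S T + (m * (S * (S ∸ 1)) + T * S)       ≡⟨ cong (edgesBefore m S T +_) (factor m S (S ∸ 1) T) ⟩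
  edgesBefore m S T + S * (m * (S ∸ 1) + T)             ∎
  where
  open ≡-Reasoning
  a = 2 * (m * m) * (S C 3) + (m C 2) * (S C 2)
  c = S C 2
  expand : ∀ a m T c d S → a + 2 * m * suc T * c + (T + d) * S ≡ a + 2 * m * T * c + d * S + (m * (2 * c) + T * S)
  expand = solve-∀
  factor : ∀ m S x T → m * (S * x) + T * S ≡ S * (m * x + T)
  factor = solve-∀

edgesBefore-sucˡ : ∀ m S → edgesBefore m (suc S) 0 ≡ edgesBefore m S m
edgesBefore-sucˡ m S rewrite [1+n]C3≡nC2+nC3 S | [1+n]C2≡n+nC2 S = regroup m (S C 2) (S C 3) (m C 2) S
  where
  regroup : ∀ m b c d S → 2 * (m * m) * (b + c) + d * (S + b) + 2 * m * 0 * (S + b) + 0 * suc S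
                        ≡ 2 * (m * m) * c + d * b + 2 * m * m * b + d * S
  regroup = solve-∀

E-at : ℕ → Coords → ℕ
E-at m (S , T , U) = E m S T U

E-end-of-row : ∀ m U T w → edgesBefore m (suc U) (suc T) + (0 + 1) * w ≡ E m (suc U) T U + w
E-end-of-row m U T w = begin
  edgesBefore m (suc U) (suc T) + (0 + 1) * w                      ≡⟨ cong (_+ (0 + 1) * w) (edgesBefore-sucʳ m (suc U) T) ⟩
  edgesBefore m (suc U) T + suc U * (m * U + T) + (0 + 1) * w      ≡⟨ regroup (edgesBefore m (suc U) T) U (m * U + T) w ⟩
  edgesBefore m (suc U) T + (U + 1) * (m * U + T) + w              ∎
  where
  open ≡-Reasoning
  regroup : ∀ a U x w → a + suc U * x + (0 + 1) * w ≡ a + (U + 1) * x + w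
  regroup = solve-∀

E-next : ∀ {m i} t → IsCoords m i t → E-at m (next m t) ≡ E-at m t + weight m (next m t)
E-next {m} (S , T , U) (T<m , U<S , _) with suc U <? S
... | yes _ = next-column (edgesBefore m S T) U (m * (S ∸ 1) + T)
  where
  next-column : ∀ a U w → a + (suc U + 1) * w ≡ a + (U + 1) * w + w
  next-column = solve-∀
... | no 1+U≮S with refl ← ≤∧≮⇒≡ U<S 1+U≮S with suc T <? m
...   | yes _ = E-end-of-row m U T (m * U + suc T)
...   | no 1+T≮m with refl ← ≤∧≮⇒≡ T<m 1+T≮m =
  trans (cong (_+ (0 + 1) * w) (edgesBefore-sucˡ m (suc U))) (E-end-of-row m U T w)
  where
  w = suc T * suc U + 0

module _ {m : ℕ} (0<m : 0 < m) where

  ∑indegree≡E-at : ∀ i → sumFrom 1 (suc i) (indegree m) ≡ E-at m (coords m i)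
  ∑indegree≡E-at zero = first-vertex m (m C 2)
    where
    first-vertex : ∀ m c → m * 0 + 0 + 0 ≡ 2 * (m * m) * 0 + c * 0 + 2 * m * 0 * 0 + 0 * 1 + (0 + 1) * (m * 0 + 0)
    first-vertex = solve-∀
  ∑indegree≡E-at (suc i) = begin
    sumFrom 1 (suc (suc i)) (indegree m)              ≡⟨ sumFrom-snoc 1 (suc i) (indegree m) ⟩
    sumFrom 1 (suc i) (indegree m) + indegree m (suc (suc i))
                                                       ≡⟨ cong (_+ indegree m (suc (suc i))) (∑indegree≡E-at i) ⟩
    E-at m (coords m i) + weight m (coords m (suc i))  ≡⟨ E-next (coords m i) (coords-correct 0<m i) ⟨
    E-at m (coords m (suc i))                          ∎
    where open ≡-Reasoning

  ∑indegree≡E : ∀ {i S T U} → IsTU m i S T U → sumFrom 1 i (indegree m) ≡ E m S T U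
  ∑indegree≡E {suc i} {S} {T} {U} tu =
    trans (∑indegree≡E-at i) (cong (E-at m) (coords-unique _ (S , T , U) (coords-correct 0<m i) tu))

proposition4 : (n k v : ℕ) → n ≡ 3 * v → 0 < v → n < 3 * k → 2 * k < n →
    (S T U : ℕ) → IsS (n ∸ 2 * k ∸ 1) v S → IsTU (n ∸ 2 * k ∸ 1) v S T U →
    numEdges v (n ∸ 2 * k ∸ 1) ≡ E (n ∸ 2 * k ∸ 1) S T U
proposition4 n k v _ _ _ _ S T U _ tu = trans (numEdges≡∑indegree {v = v} 0<m) (∑indegree≡E 0<m tu)
  where
  0<m : 0 < n ∸ 2 * k ∸ 1
  0<m = ≤-trans (s≤s z≤n) (proj₁ tu)
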